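{- Let $G$ be an abelian group. Suppose that for each $i\in\{1,\dots,q\}$ there are a finite set $F_i=\{f_{i,1},\dots,f_{i,k_i}\}\subseteq G$ with $k_i$ elements and a submonoid $M_i\subseteq G$ such that $A_i=\bigcup_{j=1}^{k_i}(f_{i,j}+M_i)=F_i+M_i$. Then for every $r\in\mathbb N$, the tuple $\mathcal A=(A_1,\dots,A_q)$ is a chromatic $\left(r,\prod_{i=1}^q\binom{(r+1)(k_i-1)}{k_i-1}\right)$-approximate group.
   Context: $\mathbb N=\{1,2,\dots\}$, $\mathbb N_0=\{0,1,2,\dots\}$. A submonoid $M\subseteq G$ satisfies $0\in M$ and $M+M\subseteq M$. For subsets $X,Y$, $X+Y=\{x+y:x\in X,y\in Y\}$; for $h\in\mathbb N$, $hA$ is the $h$-fold sumset and $0A=\{0\}$. For $\mathbf h=(h_1,\dots,h_q)\in\mathbb N_0^q$, $\mathbf h\cdot\mathcal A=h_1A_1+\cdots+h_qA_q$ and $r\mathbf h=(rh_1,\dots,rh_q)$. $\mathcal A$ is a chromatic $(r,\ell)$-approximate group if for every $\mathbf h\in\mathbb N_0^q$ there is $X_{\mathbf h}\subseteq G$ with $|X_{\mathbf h}|\le\ell$ and $(r\mathbf h)\cdot\mathcal A\subseteq X_{\mathbf h}+\mathbf h\cdot\mathcal A$. -}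

module Defs where

open import Level using (Level; _⊔_; Lift)
open import Algebra.Bundles using (AbelianGroup)
open import Data.Nat using (ℕ; zero; suc; _*_; _∸_; _≤_) renaming (_+_ to _+ℕ_)
open import Data.Nat.Combinatorics using (_C_)
open import Data.Fin using (Fin; zero; suc)
open import Data.List using (List; length; tabulate)
open import Data.Nat.ListAction using (product)
open import Data.List.Relation.Unary.Any using (Any)
open import Data.Product using (Σ; ∃; ∃-syntax; _×_)
open import Relation.Binary.PropositionalEquality using (_≡_)

module _ {c ℓ : Level} (G : AbelianGroup c ℓ) where
  open AbelianGroup G

  Subset : Set (Level.suc (c ⊔ ℓ))
  Subset = Carrier → Set (c ⊔ ℓ)

  _⊆_ : Subset → Subset → Set (c ⊔ ℓ)
  X ⊆ Y = ∀ z → X z → Y z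

  _⊕_ : Subset → Subset → Subset
  (X ⊕ Y) z = ∃[ x ] ∃[ y ] (X x × Y y × z ≈ x ∙ y)

  zeroSet : Subset
  zeroSet z = Lift c (z ≈ ε)

  _·_ : ℕ → Subset → Subset
  zero  · A = zeroSet
  suc h · A = A ⊕ (h · A)

  dot : (q : ℕ) → (Fin q → ℕ) → (Fin q → Subset) → Subset
  dot zero    h A = zeroSet
  dot (suc q) h A = (h zero · A zero) ⊕ dot q (λ i → h (suc i)) (λ i → A (suc i))

  listSet : List Carrier → Subset
  listSet X z = Any (λ x → z ≈ x) X

  image : {k : ℕ} → (Fin k → Carrier) → Subset
  image {k} f z = Lift c (∃[ j ] (z ≈ f j))

  IsSubmonoid : Subset → Set (c ⊔ ℓ)
  IsSubmonoid M = (∀ {x y} → x ≈ y → M x → M y)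
                × M ε
                × (∀ {x y} → M x → M y → M (x ∙ y))

  -- 𝒜 is a chromatic (r, L)-approximate group; a finite set X with |X| ≤ L
  -- is given by a list of length ≤ L
  IsChromaticApproxGroup : (q : ℕ) → (Fin q → Subset) → ℕ → ℕ → Set (c ⊔ ℓ)
  IsChromaticApproxGroup q A r L =
    ∀ (h : Fin q → ℕ) → Σ (List Carrier) λ X →
      length X ≤ L × (dot q (λ i → r * h i) A ⊆ (listSet X ⊕ dot q h A))

bound : (q : ℕ) → (Fin q → ℕ) → ℕ → ℕ
bound q k r = product (tabulate {n = q} (λ i → (suc r * (k i ∸ 1)) C (k i ∸ 1)))

{-# OPTIONS --safe #-}
module Submission where

-- An element of h(F + M) is Σⱼ cⱼ fⱼ + m with c ∈ ℕᵏ, Σ c = h and m ∈ M. Given such a c with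
-- Σ c = (r + 1) h, put N = k − 1 and pick y ≤ ⌊N c / h⌋ entrywise with Σ y = r N; this is possible
-- because the k floors lose less than k in total. Scaling y back by h / N, rounding along prefix
-- sums so that nothing is lost, gives x ≤ c with Σ x = r h. Hence the element lies in
-- (Σⱼ xⱼ fⱼ) + h(F + M), and the translate depends only on y, a composition of r N into k parts:
-- there are C(r N + k − 1, k − 1) ≤ C((r + 2)(k − 1), k − 1) of them, whatever h is.
-- For a tuple the sets of translates are added, so their sizes multiply.

open import Defs
open import Level using (Level; _⊔_; lift)
open import Algebra.Bundles using (AbelianGroup)
open import Data.Nat
  using (ℕ; zero; suc; _+_; _*_; _∸_; _/_; _%_; _≤_; _<_; _≤′_; ≤′-refl; ≤′-step; z≤n; s≤s; s≤s⁻¹; NonZero)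
open import Data.Nat.Properties
open import Data.Nat.DivMod using (m≡m%n+[m/n]*n; m%n<n; m/n*n≤m; /-monoˡ-≤; +-distrib-/-∣ʳ; m*n/n≡m; 0/n≡0)
open import Data.Nat.Divisibility using (n∣m*n)
open import Data.Nat.Combinatorics using (_C_; nCn≡1; nCk+nC[k+1]≡[n+1]C[k+1])
open import Data.Nat.ListAction using (product)
open import Data.Nat.Solver using (module +-*-Solver)
open import Data.Fin using (Fin; zero; suc)
open import Data.Vec as Vec using (Vec; []; _∷_; sum; zipWith; replicate; updateAt)
open import Data.Vec.Relation.Binary.Pointwise.Inductive as Pointwise using (Pointwise; []; _∷_)
open import Data.List as List using (List; []; _∷_; _++_; length; tabulate; cartesianProductWith)
open import Data.List.Properties using (length-++; length-map)
open import Data.List.Relation.Unary.Any as Any using (Any; here)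
open import Data.List.Relation.Unary.Any.Properties using (++⁺ˡ; ++⁺ʳ; cartesianProductWith⁺)
open import Data.List.Membership.Propositional using (_∈_)
open import Data.List.Membership.Propositional.Properties using (∈-map⁺)
open import Data.Product using (Σ; ∃-syntax; _×_; _,_; proj₁; proj₂)
open import Data.Sum using (inj₁; inj₂)
open import Function using (_∘_)
open import Relation.Binary.PropositionalEquality
  using (_≡_; refl; sym; trans; cong; cong₂; subst; module ≡-Reasoning)

open +-*-Solver using (solve; _:+_; _:*_; _:=_; con)

_≤ᵛ_ : ∀ {k} → Vec ℕ k → Vec ℕ k → Set
_≤ᵛ_ = Pointwise _≤_

_+ᵛ_ _∸ᵛ_ : ∀ {k} → Vec ℕ k → Vec ℕ k → Vec ℕ k
_+ᵛ_ = zipWith _+_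
_∸ᵛ_ = zipWith _∸_

increment : ∀ {k} → Fin k → Vec ℕ k → Vec ℕ k
increment j c = updateAt c j suc

sum-+ᵛ : ∀ {k} (u v : Vec ℕ k) → sum (u +ᵛ v) ≡ sum u + sum v
sum-+ᵛ []      []      = refl
sum-+ᵛ (a ∷ u) (b ∷ v) = begin
  (a + b) + sum (u +ᵛ v)    ≡⟨ cong ((a + b) +_) (sum-+ᵛ u v) ⟩
  (a + b) + (sum u + sum v) ≡⟨ +-interchange a b (sum u) (sum v) ⟩
  (a + sum u) + (b + sum v) ∎
  where
  open ≡-Reasoning
  open import Algebra.Properties.CommutativeSemigroup +-commutativeSemigroup
    using () renaming (interchange to +-interchange)

+ᵛ-∸ᵛ : ∀ {k} {x c : Vec ℕ k} → x ≤ᵛ c → x +ᵛ (c ∸ᵛ x) ≡ c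
+ᵛ-∸ᵛ []       = refl
+ᵛ-∸ᵛ (p ∷ ps) = cong₂ _∷_ (m+[n∸m]≡n p) (+ᵛ-∸ᵛ ps)

sum-∸ᵛ : ∀ {k} {x c : Vec ℕ k} → x ≤ᵛ c → sum (c ∸ᵛ x) ≡ sum c ∸ sum x
sum-∸ᵛ {x = x} {c} x≤c = begin
  sum (c ∸ᵛ x)                  ≡⟨ m+n∸m≡n (sum x) (sum (c ∸ᵛ x)) ⟨
  sum x + sum (c ∸ᵛ x) ∸ sum x  ≡⟨ cong (_∸ sum x) (sum-+ᵛ x (c ∸ᵛ x)) ⟨
  sum (x +ᵛ (c ∸ᵛ x)) ∸ sum x   ≡⟨ cong (λ v → sum v ∸ sum x) (+ᵛ-∸ᵛ x≤c) ⟩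
  sum c ∸ sum x                 ∎
  where open ≡-Reasoning

sum-replicate-0 : ∀ k → sum (replicate k 0) ≡ 0
sum-replicate-0 zero    = refl
sum-replicate-0 (suc k) = sum-replicate-0 k

sum≡0⇒replicate : ∀ {k} (c : Vec ℕ k) → sum c ≡ 0 → c ≡ replicate k 0
sum≡0⇒replicate []          _  = refl
sum≡0⇒replicate (zero ∷ c) eq = cong (0 ∷_) (sum≡0⇒replicate c eq)

sum-increment : ∀ {k} (j : Fin k) (c : Vec ℕ k) → sum (increment j c) ≡ suc (sum c)
sum-increment zero    (a ∷ c) = refl
sum-increment (suc j) (a ∷ c) = trans (cong (a +_) (sum-increment j c)) (+-suc a (sum c))

sum≡suc⇒increment : ∀ {k n} (c : Vec ℕ k) → sum c ≡ suc n →
                    ∃[ j ] ∃[ c′ ] c ≡ increment j c′ × sum c′ ≡ n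
sum≡suc⇒increment (suc a ∷ c) eq = zero , a ∷ c , refl , suc-injective eq
sum≡suc⇒increment (zero  ∷ c) eq with sum≡suc⇒increment c eq
... | j , c′ , refl , eq′ = suc j , 0 ∷ c′ , refl , eq′

≤-sum⇒∃≤ᵛ : ∀ {k s} (u : Vec ℕ k) → s ≤ sum u → ∃[ y ] y ≤ᵛ u × sum y ≡ s
≤-sum⇒∃≤ᵛ         []      z≤n = [] , [] , refl
≤-sum⇒∃≤ᵛ {s = s} (a ∷ u) s≤ with ≤-total s (sum u)
... | inj₁ s≤u = let y , y≤u , sum-y = ≤-sum⇒∃≤ᵛ u s≤u in 0 ∷ y , z≤n ∷ y≤u , sum-y
... | inj₂ u≤s =
  (s ∸ sum u) ∷ u ,
  m≤n+o⇒m∸n≤o s (sum u) (subst (s ≤_) (+-comm a (sum u)) s≤) ∷ Pointwise.refl ≤-refl ,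
  m∸n+n≡m u≤s

compositions : (k s : ℕ) → List (Vec ℕ k)
compositions zero    zero    = [] ∷ []
compositions zero    (suc s) = []
compositions (suc k) zero    = replicate (suc k) 0 ∷ []
compositions (suc k) (suc s) =
  List.map (0 ∷_) (compositions k (suc s)) ++ List.map (increment zero) (compositions (suc k) s)

sum≡⇒∈-compositions : ∀ {k s} (y : Vec ℕ k) → sum y ≡ s → y ∈ compositions k s
sum≡⇒∈-compositions {s = zero}  []          _  = here refl
sum≡⇒∈-compositions {s = zero}  y@(_ ∷ _)   eq = here (sum≡0⇒replicate y eq)
sum≡⇒∈-compositions {s = suc s} (zero ∷ y)  eq =
  ++⁺ˡ (∈-map⁺ (0 ∷_) (sum≡⇒∈-compositions y eq))
sum≡⇒∈-compositions {s = suc s} (suc a ∷ y) eq =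
  ++⁺ʳ _ (∈-map⁺ (increment zero) (sum≡⇒∈-compositions (a ∷ y) (suc-injective eq)))

length-compositions : ∀ k s → length (compositions (suc k) s) ≡ (s + k) C k
length-compositions k       zero    = sym (nCn≡1 k)
length-compositions zero    (suc s) =
  trans (length-map (increment zero) (compositions 1 s)) (length-compositions zero s)
length-compositions (suc k) (suc s) = begin
  length (List.map (0 ∷_) left ++ List.map (increment zero) right)
    ≡⟨ length-++ (List.map (0 ∷_) left) ⟩
  length (List.map (0 ∷_) left) + length (List.map (increment zero) right)
    ≡⟨ cong₂ _+_ (length-map (0 ∷_) left) (length-map (increment zero) right) ⟩
  length left + length right
    ≡⟨ cong₂ _+_ (length-compositions k (suc s)) (length-compositions (suc k) s) ⟩
  (suc s + k) C k + (s + suc k) C suc k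
    ≡⟨ cong (λ n → n C k + (s + suc k) C suc k) (sym (+-suc s k)) ⟩
  (s + suc k) C k + (s + suc k) C suc k
    ≡⟨ nCk+nC[k+1]≡[n+1]C[k+1] (s + suc k) k ⟩
  suc (s + suc k) C suc k ∎
  where
  open ≡-Reasoning
  left  = compositions (suc k) (suc s)
  right = compositions (suc (suc k)) s

nCk≤[n+1]Ck : ∀ n m → n C m ≤ suc n C m
nCk≤[n+1]Ck n zero    = ≤-refl
nCk≤[n+1]Ck n (suc m) = subst (n C suc m ≤_) (nCk+nC[k+1]≡[n+1]C[k+1] n m) (m≤n+m _ _)

C-monoˡ-≤ : ∀ m {n n′} → n ≤ n′ → n C m ≤ n′ C m
C-monoˡ-≤ m = go ∘ ≤⇒≤′
  where
  go : ∀ {n n′} → n ≤′ n′ → n C m ≤ n′ C m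
  go ≤′-refl         = ≤-refl
  go (≤′-step n≤′n′) = ≤-trans (go n≤′n′) (nCk≤[n+1]Ck _ m)

length-cartesianProductWith : ∀ {a b c} {A : Set a} {B : Set b} {C : Set c} (f : A → B → C) xs ys →
                              length (cartesianProductWith f xs ys) ≡ length xs * length ys
length-cartesianProductWith f []       ys = refl
length-cartesianProductWith f (x ∷ xs) ys =
  trans (length-++ (List.map (f x) ys))
        (cong₂ _+_ (length-map (f x) ys) (length-cartesianProductWith f xs ys))

m<n*[m/n+1] : ∀ m n .{{_ : NonZero n}} → m < n * (m / n + 1)
m<n*[m/n+1] m n = begin-strict
  m                       ≡⟨ m≡m%n+[m/n]*n m n ⟩
  m % n + (m / n) * n     <⟨ +-monoˡ-< ((m / n) * n) (m%n<n m n) ⟩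
  n + (m / n) * n         ≡⟨ solve 2 (λ n q → n :+ q :* n := n :* (q :+ con 1)) refl n (m / n) ⟩
  n * (m / n + 1)         ∎
  where open ≤-Reasoning

module Rounding (N h : ℕ) .{{_ : NonZero N}} .{{_ : NonZero h}} where

  scaledFloor : ∀ {k} → Vec ℕ k → Vec ℕ k
  scaledFloor = Vec.map (λ a → N * a / h)

  sum-scaledFloor-lowerBound : ∀ {k} (c : Vec ℕ k) → N * sum c + k ≤ h * (sum (scaledFloor c) + k)
  sum-scaledFloor-lowerBound []      = ≤-reflexive (solve 2 (λ N h → N :* con 0 :+ con 0 := h :* (con 0 :+ con 0)) refl N h)
  sum-scaledFloor-lowerBound {suc k} (a ∷ c) = begin
    N * (a + sum c) + suc k
      ≡⟨ solve 4 (λ N a S k → N :* (a :+ S) :+ (con 1 :+ k) := (con 1 :+ N :* a) :+ (N :* S :+ k)) refl N a (sum c) k ⟩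
    suc (N * a) + (N * sum c + k)
      ≤⟨ +-mono-≤ (m<n*[m/n+1] (N * a) h) (sum-scaledFloor-lowerBound c) ⟩
    h * (u + 1) + h * (U + k)
      ≡⟨ solve 4 (λ h u U k → h :* (u :+ con 1) :+ h :* (U :+ k) := h :* ((u :+ U) :+ (con 1 :+ k))) refl h u U k ⟩
    h * ((u + U) + suc k) ∎
    where
    open ≤-Reasoning
    u = N * a / h
    U = sum (scaledFloor c)

  -- Σ⌊N cⱼ/h⌋ > N (r + 1) − (k + 1) ≥ r N − 1, since c has k + 1 entries and k ≤ N.
  r*N≤sum-scaledFloor : ∀ {k} r → k ≤ N → (c : Vec ℕ (suc k)) → sum c ≡ suc r * h →
                        r * N ≤ sum (scaledFloor c)
  r*N≤sum-scaledFloor {k} r k≤N c sum-c = +-cancelʳ-≤ N (r * N) U (s≤s⁻¹ (*-cancelˡ-< h _ _ (begin-strict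
    h * (r * N + N)      ≡⟨ solve 3 (λ h r N → h :* (r :* N :+ N) := N :* ((con 1 :+ r) :* h)) refl h r N ⟩
    N * (suc r * h)      ≡⟨ cong (N *_) sum-c ⟨
    N * sum c            <⟨ m<m+n (N * sum c) (s≤s z≤n) ⟩
    N * sum c + suc k    ≤⟨ sum-scaledFloor-lowerBound c ⟩
    h * (U + suc k)      ≤⟨ *-monoʳ-≤ h (+-monoʳ-≤ U (s≤s k≤N)) ⟩
    h * (U + suc N)      ≡⟨ cong (h *_) (+-suc U N) ⟩
    h * suc (U + N)      ∎)))
    where
    open ≤-Reasoning
    U = sum (scaledFloor c)

  -- Successive differences of ⌊h · (prefix sums of y, offset by Y) / N⌋: they telescope,
  -- and the j-th one is at most ⌈h yⱼ / N⌉.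
  rescale : ∀ {k} → ℕ → Vec ℕ k → Vec ℕ k
  rescale Y []      = []
  rescale Y (b ∷ y) = (h * (Y + b) / N ∸ h * Y / N) ∷ rescale (Y + b) y

  sum-rescale : ∀ {k} Y (y : Vec ℕ k) → sum (rescale Y y) + h * Y / N ≡ h * (Y + sum y) / N
  sum-rescale Y []      = cong (λ t → h * t / N) (sym (+-identityʳ Y))
  sum-rescale Y (b ∷ y) = begin
    (d + R) + h * Y / N      ≡⟨ solve 3 (λ d R z → (d :+ R) :+ z := R :+ (d :+ z)) refl d R (h * Y / N) ⟩
    R + (d + h * Y / N)      ≡⟨ cong (R +_) (m∸n+n≡m (/-monoˡ-≤ N (*-monoʳ-≤ h (m≤m+n Y b)))) ⟩
    R + h * (Y + b) / N      ≡⟨ sum-rescale (Y + b) y ⟩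
    h * (Y + b + sum y) / N  ≡⟨ cong (λ t → h * t / N) (+-assoc Y b (sum y)) ⟩
    h * (Y + (b + sum y)) / N ∎
    where
    open ≡-Reasoning
    d = h * (Y + b) / N ∸ h * Y / N
    R = sum (rescale (Y + b) y)

  sum-rescale-0 : ∀ {k} r (y : Vec ℕ k) → sum y ≡ r * N → sum (rescale 0 y) ≡ h * r
  sum-rescale-0 r y sum-y = begin
    sum (rescale 0 y)               ≡⟨ +-identityʳ _ ⟨
    sum (rescale 0 y) + 0           ≡⟨ cong (sum (rescale 0 y) +_) (0/n≡0 N) ⟨
    sum (rescale 0 y) + 0 / N       ≡⟨ cong (λ t → sum (rescale 0 y) + t / N) (*-zeroʳ h) ⟨
    sum (rescale 0 y) + h * 0 / N   ≡⟨ sum-rescale 0 y ⟩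
    h * sum y / N                   ≡⟨ cong (λ t → h * t / N) sum-y ⟩
    h * (r * N) / N                 ≡⟨ cong (_/ N) (*-assoc h r N) ⟨
    h * r * N / N                   ≡⟨ m*n/n≡m (h * r) N ⟩
    h * r                           ∎
    where open ≡-Reasoning

  rescale-≤ᵛ : ∀ {k} Y {y c : Vec ℕ k} → y ≤ᵛ scaledFloor c → rescale Y y ≤ᵛ c
  rescale-≤ᵛ Y {[]}    {[]}    []       = []
  rescale-≤ᵛ Y {b ∷ y} {a ∷ c} (p ∷ ps) = entry ∷ rescale-≤ᵛ (Y + b) ps
    where
    hb≤aN : h * b ≤ a * N
    hb≤aN = begin
      h * b           ≡⟨ *-comm h b ⟩
      b * h           ≤⟨ *-monoˡ-≤ h p ⟩
      (N * a / h) * h ≤⟨ m/n*n≤m (N * a) h ⟩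
      N * a           ≡⟨ *-comm N a ⟩
      a * N           ∎
      where open ≤-Reasoning
    entry : h * (Y + b) / N ∸ h * Y / N ≤ a
    entry = m≤n+o⇒m∸n≤o (h * (Y + b) / N) (h * Y / N) (begin
      h * (Y + b) / N        ≡⟨ cong (_/ N) (*-distribˡ-+ h Y b) ⟩
      (h * Y + h * b) / N    ≤⟨ /-monoˡ-≤ N (+-monoʳ-≤ (h * Y) hb≤aN) ⟩
      (h * Y + a * N) / N    ≡⟨ +-distrib-/-∣ʳ (h * Y) (n∣m*n a) ⟩
      h * Y / N + a * N / N  ≡⟨ cong (h * Y / N +_) (m*n/n≡m a N) ⟩
      h * Y / N + a          ∎)
      where open ≤-Reasoning

  roundedPart : ∀ {k} r → k ≤ N → (c : Vec ℕ (suc k)) → sum c ≡ suc r * h →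
                ∃[ y ] sum y ≡ r * N × rescale 0 y ≤ᵛ c
  roundedPart r k≤N c sum-c with ≤-sum⇒∃≤ᵛ (scaledFloor c) (r*N≤sum-scaledFloor r k≤N c sum-c)
  ... | y , y≤ , sum-y = y , sum-y , rescale-≤ᵛ 0 y≤

module _ {g ℓ : Level} (G : AbelianGroup g ℓ) where
  open AbelianGroup G renaming (refl to ≈-refl; sym to ≈-sym; trans to ≈-trans)
  open import Algebra.Properties.Monoid.Mult monoid using (×-homo-+) renaming (_×_ to _•_)
  open import Algebra.Properties.CommutativeSemigroup commutativeSemigroup using (interchange; x∙yz≈y∙xz)
  open import Relation.Binary.Reasoning.Setoid setoid

  private
    infixr 6 _⊕ᴳ_
    infix  7 _·ᴳ_
    infix  4 _⊆ᴳ_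

    _⊕ᴳ_ : Subset G → Subset G → Subset G
    _⊕ᴳ_ = _⊕_ G

    _·ᴳ_ : ℕ → Subset G → Subset G
    _·ᴳ_ = _·_ G

    _⊆ᴳ_ : Subset G → Subset G → Set (g ⊔ ℓ)
    _⊆ᴳ_ = _⊆_ G

  lincomb : ∀ {k} → (Fin k → Carrier) → Vec ℕ k → Carrier
  lincomb f []      = ε
  lincomb f (n ∷ c) = n • f zero ∙ lincomb (f ∘ suc) c

  lincomb-+ᵛ : ∀ {k} (f : Fin k → Carrier) (u v : Vec ℕ k) → lincomb f (u +ᵛ v) ≈ lincomb f u ∙ lincomb f v
  lincomb-+ᵛ f []      []      = ≈-sym (identityˡ ε)
  lincomb-+ᵛ f (m ∷ u) (n ∷ v) = begin
    (m + n) • f zero ∙ lincomb (f ∘ suc) (u +ᵛ v)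
      ≈⟨ ∙-cong (×-homo-+ (f zero) m n) (lincomb-+ᵛ (f ∘ suc) u v) ⟩
    (m • f zero ∙ n • f zero) ∙ (lincomb (f ∘ suc) u ∙ lincomb (f ∘ suc) v)
      ≈⟨ interchange _ _ _ _ ⟩
    (m • f zero ∙ lincomb (f ∘ suc) u) ∙ (n • f zero ∙ lincomb (f ∘ suc) v) ∎

  lincomb-increment : ∀ {k} (f : Fin k → Carrier) j (c : Vec ℕ k) →
                      lincomb f (increment j c) ≈ f j ∙ lincomb f c
  lincomb-increment f zero    (n ∷ c) = assoc _ _ _
  lincomb-increment f (suc j) (n ∷ c) =
    ≈-trans (∙-congˡ (lincomb-increment (f ∘ suc) j c)) (x∙yz≈y∙xz _ _ _)

  lincomb-sum≡0 : ∀ {k} (f : Fin k → Carrier) (c : Vec ℕ k) → sum c ≡ 0 → lincomb f c ≈ ε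
  lincomb-sum≡0 f []         _  = ≈-refl
  lincomb-sum≡0 f (zero ∷ c) eq = ≈-trans (identityˡ _) (lincomb-sum≡0 (f ∘ suc) c eq)

  cosets : ∀ {k} → (Fin k → Carrier) → Subset G → Subset G
  cosets f M = image G f ⊕ᴳ M

  module _ {k} (f : Fin k → Carrier) {M : Subset G} (M-sub : IsSubmonoid G M) where
    private
      M-ε : M ε
      M-ε = proj₁ (proj₂ M-sub)

      M-∙ : ∀ {x y} → M x → M y → M (x ∙ y)
      M-∙ = proj₂ (proj₂ M-sub)

    ∈sumset⇒lincomb : ∀ h {z} → (h ·ᴳ cosets f M) z →
                      ∃[ c ] sum c ≡ h × ∃[ m ] M m × z ≈ lincomb f c ∙ m
    ∈sumset⇒lincomb zero (lift z≈ε) = replicate k 0 , sum-replicate-0 k , ε , M-ε ,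
      ≈-trans z≈ε (≈-sym (≈-trans (∙-congʳ (lincomb-sum≡0 f (replicate k 0) (sum-replicate-0 k)))
                                  (identityʳ ε)))
    ∈sumset⇒lincomb (suc h) {z} (x , w , (y , m₁ , lift (j , y≈fj) , m₁∈M , x≈y∙m₁) , w∈ , z≈x∙w)
      with ∈sumset⇒lincomb h w∈
    ... | c , sum-c , m , m∈M , w≈ =
      increment j c , trans (sum-increment j c) (cong suc sum-c) , m₁ ∙ m , M-∙ m₁∈M m∈M , (begin
        z                                   ≈⟨ z≈x∙w ⟩
        x ∙ w                               ≈⟨ ∙-cong (≈-trans x≈y∙m₁ (∙-congʳ y≈fj)) w≈ ⟩
        (f j ∙ m₁) ∙ (lincomb f c ∙ m)      ≈⟨ interchange _ _ _ _ ⟩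
        (f j ∙ lincomb f c) ∙ (m₁ ∙ m)      ≈⟨ ∙-congʳ (lincomb-increment f j c) ⟨
        lincomb f (increment j c) ∙ (m₁ ∙ m) ∎)

    lincomb∈sumset : ∀ n (c : Vec ℕ k) {m} → sum c ≡ suc n → M m → (suc n ·ᴳ cosets f M) (lincomb f c ∙ m)
    lincomb∈sumset n c sum-c m∈M with sum≡suc⇒increment c sum-c
    lincomb∈sumset zero    _ {m} _ m∈M | j , c , refl , sum-c =
      f j ∙ m , ε , (f j , m , lift (j , ≈-refl) , m∈M , ≈-refl) , lift ≈-refl , (begin
        lincomb f (increment j c) ∙ m   ≈⟨ ∙-congʳ (lincomb-increment f j c) ⟩
        (f j ∙ lincomb f c) ∙ m         ≈⟨ ∙-congʳ (∙-congˡ (lincomb-sum≡0 f c sum-c)) ⟩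
        (f j ∙ ε) ∙ m                   ≈⟨ ∙-congʳ (identityʳ _) ⟩
        f j ∙ m                         ≈⟨ identityʳ _ ⟨
        (f j ∙ m) ∙ ε                   ∎)
    lincomb∈sumset (suc n) _ {m} _ m∈M | j , c , refl , sum-c =
      f j ∙ ε , lincomb f c ∙ m , (f j , ε , lift (j , ≈-refl) , M-ε , ≈-refl) ,
      lincomb∈sumset n c sum-c m∈M , (begin
        lincomb f (increment j c) ∙ m   ≈⟨ ∙-congʳ (lincomb-increment f j c) ⟩
        (f j ∙ lincomb f c) ∙ m         ≈⟨ assoc _ _ _ ⟩
        f j ∙ (lincomb f c ∙ m)         ≈⟨ ∙-congʳ (identityʳ _) ⟨
        (f j ∙ ε) ∙ (lincomb f c ∙ m)   ∎)

  module _ {k} (f : Fin (suc k) → Carrier) {M : Subset G} (M-sub : IsSubmonoid G M)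
           (N : ℕ) .{{_ : NonZero N}} (k≤N : k ≤ N) (r h : ℕ) where
    open Rounding N (suc h)

    translates : List Carrier
    translates = List.map (lincomb f ∘ rescale 0) (compositions (suc k) (r * N))

    length-translates : length translates ≡ (r * N + k) C k
    length-translates =
      trans (length-map (lincomb f ∘ rescale 0) (compositions (suc k) (r * N))) (length-compositions k (r * N))

    sumset-cover : (suc r * suc h) ·ᴳ cosets f M ⊆ᴳ listSet G translates ⊕ᴳ suc h ·ᴳ cosets f M
    sumset-cover z z∈ with ∈sumset⇒lincomb f M-sub (suc r * suc h) z∈
    ... | c , sum-c , m , m∈M , z≈ with roundedPart r k≤N c sum-c
    ... | y , sum-y , x≤c =
      lincomb f x , lincomb f (c ∸ᵛ x) ∙ m , x∈ , lincomb∈sumset f M-sub h (c ∸ᵛ x) sum-c∸x m∈M , (begin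
        z                                       ≈⟨ z≈ ⟩
        lincomb f c ∙ m                         ≈⟨ ∙-congʳ (reflexive (cong (lincomb f) (+ᵛ-∸ᵛ x≤c))) ⟨
        lincomb f (x +ᵛ (c ∸ᵛ x)) ∙ m           ≈⟨ ∙-congʳ (lincomb-+ᵛ f x (c ∸ᵛ x)) ⟩
        (lincomb f x ∙ lincomb f (c ∸ᵛ x)) ∙ m  ≈⟨ assoc _ _ _ ⟩
        lincomb f x ∙ (lincomb f (c ∸ᵛ x) ∙ m)  ∎)
      where
      x : Vec ℕ (suc k)
      x = rescale 0 y
      x∈ : Any (lincomb f x ≈_) translates
      x∈ = Any.map reflexive (∈-map⁺ (lincomb f ∘ rescale 0) (sum≡⇒∈-compositions y sum-y))
      sum-c∸x : sum (c ∸ᵛ x) ≡ suc h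
      sum-c∸x = trans (sum-∸ᵛ x≤c)
        (trans (cong₂ _∸_ sum-c (trans (sum-rescale-0 r y sum-y) (*-comm (suc h) r)))
               (m+n∸n≡m (suc h) (r * suc h)))

  IsApproxGroup : Subset G → ℕ → ℕ → Set (g ⊔ ℓ)
  IsApproxGroup A r L =
    ∀ h → Σ (List Carrier) λ X → length X ≤ L × (r * h) ·ᴳ A ⊆ᴳ listSet G X ⊕ᴳ h ·ᴳ A

  -- The translates come from compositions of r N with N = k − 1, or N = 1 when k = 1.
  cosets-isApproxGroup : ∀ {k} (f : Fin k → Carrier) {M} → IsSubmonoid G M → ∀ r →
                         IsApproxGroup (cosets f M) (suc r) ((suc (suc r) * (k ∸ 1)) C (k ∸ 1))
  cosets-isApproxGroup {k} f {M} M-sub r zero =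
    ε ∷ [] , 1≤C , λ z z∈ →
      ε , z , here ≈-refl , subst (λ n → (n ·ᴳ cosets f M) z) (*-zeroʳ (suc r)) z∈ , ≈-sym (identityˡ z)
    where
    1≤C : 1 ≤ (suc (suc r) * (k ∸ 1)) C (k ∸ 1)
    1≤C = ≤-trans (≤-reflexive (sym (nCn≡1 (k ∸ 1)))) (C-monoˡ-≤ (k ∸ 1) (m≤n*m (k ∸ 1) (suc (suc r))))
  cosets-isApproxGroup {zero} f M-sub r (suc h) =
    [] , z≤n , λ { z (_ , _ , (_ , _ , lift (() , _) , _) , _) }
  cosets-isApproxGroup {suc zero} f M-sub r (suc h) =
    translates f M-sub 1 z≤n r h ,
    ≤-reflexive (length-translates f M-sub 1 z≤n r h) ,
    sumset-cover f M-sub 1 z≤n r h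
  cosets-isApproxGroup {suc (suc k)} f M-sub r (suc h) =
    translates f M-sub N ≤-refl r h ,
    ≤-trans (≤-reflexive (length-translates f M-sub N ≤-refl r h)) (C-monoˡ-≤ N r*N+N≤[2+r]*N) ,
    sumset-cover f M-sub N ≤-refl r h
    where
    N = suc k
    r*N+N≤[2+r]*N : r * N + N ≤ suc (suc r) * N
    r*N+N≤[2+r]*N = subst (_≤ suc (suc r) * N) (+-comm N (r * N)) (m≤n+m (N + r * N) N)

  chromatic-product : ∀ q r {A : Fin q → Subset G} {L : Fin q → ℕ} → (∀ i → IsApproxGroup (A i) r (L i)) →
                      IsChromaticApproxGroup G q A r (product (tabulate L))
  chromatic-product zero    r _      h = ε ∷ [] , ≤-refl , λ z z∈ → ε , z , here ≈-refl , z∈ , ≈-sym (identityˡ z)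
  chromatic-product (suc q) r {A} {L} approx h
    with approx zero (h zero) | chromatic-product q r {A ∘ suc} {L ∘ suc} (approx ∘ suc) (h ∘ suc)
  ... | X , |X|≤ , X-cover | Y , |Y|≤ , Y-cover =
    cartesianProductWith _∙_ X Y ,
    ≤-trans (≤-reflexive (length-cartesianProductWith _∙_ X Y)) (*-mono-≤ |X|≤ |Y|≤) ,
    cover
    where
    cover : dot G (suc q) (λ i → r * h i) A ⊆ᴳ listSet G (cartesianProductWith _∙_ X Y) ⊕ᴳ dot G (suc q) h A
    cover z (a , b , a∈ , b∈ , z≈a∙b) with X-cover a a∈ | Y-cover b b∈
    ... | x , a′ , x∈ , a′∈ , a≈x∙a′ | y , b′ , y∈ , b′∈ , b≈y∙b′ =
      x ∙ y , a′ ∙ b′ , cartesianProductWith⁺ _∙_ ∙-cong x∈ y∈ , (a′ , b′ , a′∈ , b′∈ , ≈-refl) , (begin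
        z                     ≈⟨ z≈a∙b ⟩
        a ∙ b                 ≈⟨ ∙-cong a≈x∙a′ b≈y∙b′ ⟩
        (x ∙ a′) ∙ (y ∙ b′)   ≈⟨ interchange _ _ _ _ ⟩
        (x ∙ y) ∙ (a′ ∙ b′)   ∎)

corollary2p12 : {c ℓ : Level} (G : AbelianGroup c ℓ) (q : ℕ)
    (k : Fin q → ℕ)
    (F : (i : Fin q) → Fin (k i) → AbelianGroup.Carrier G)
    (F-distinct : ∀ i a b → AbelianGroup._≈_ G (F i a) (F i b) → a ≡ b)
    (M : Fin q → Subset G)
    (M-sub : ∀ i → IsSubmonoid G (M i))
    (r : ℕ) →
    IsChromaticApproxGroup G q (λ i → _⊕_ G (image G (F i)) (M i)) (suc r) (bound q k (suc r))
-- The fⱼ need not be distinct: the argument only uses the enumeration F i of each Fᵢ.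
corollary2p12 G q k F _ M M-sub r =
  chromatic-product G q (suc r) (λ i → cosets-isApproxGroup G (F i) (M-sub i) r)
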